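{- Let $G$ be a connected stepwise irregular graph. Then for every vertex $v$ of $G$, the graph $G-v$ is not stepwise irregular.
   Context: All graphs are finite and simple. A graph $G$ is stepwise irregular (SI) if for every edge $uv\in E(G)$ one has $|d_G(u)-d_G(v)|=1$, where $d_G$ denotes degree; a disconnected graph is called SI if each of its connected components is SI. $G-v$ denotes the graph obtained from $G$ by deleting the vertex $v$ and all edges incident to it. -}

module Defs where

open import Data.Nat.Base using (ℕ; zero; suc; ∣_-_∣)
open import Data.Bool.Base using (Bool; true; false; if_then_else_)
open import Data.Fin.Base using (Fin; punchIn)
open import Data.List.Base using (List; map)
open import Data.Nat.ListAction using (sum)
open import Data.Product.Base using (Σ; _×_; ∃-syntax)
open import Relation.Binary.PropositionalEquality using (_≡_)
import Data.List as L

record Graph (n : ℕ) : Set where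
  field
    adj    : Fin n → Fin n → Bool
    sym    : ∀ i j → adj i j ≡ adj j i
    irrefl : ∀ i → adj i i ≡ false
open Graph public

Adj : ∀ {n} → Graph n → Fin n → Fin n → Set
Adj G u w = adj G u w ≡ true

degree : ∀ {n} → Graph n → Fin n → ℕ
degree {n} G v = sum (map (λ j → if adj G v j then 1 else 0) (L.allFin n))

data Reachable {n : ℕ} (G : Graph n) : Fin n → Fin n → Set where
  here : ∀ {u} → Reachable G u u
  step : ∀ {u w v} → Adj G u w → Reachable G w v → Reachable G u v

Connected : ∀ {n} → Graph n → Set
Connected {n} G = ∀ (u v : Fin n) → Reachable G u v

deleteVertex : ∀ {n} → Graph (suc n) → Fin (suc n) → Graph n
deleteVertex G v = record
  { adj    = λ i j → adj G (punchIn v i) (punchIn v j)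
  ; sym    = λ i j → sym G (punchIn v i) (punchIn v j)
  ; irrefl = λ i → irrefl G (punchIn v i)
  }

-- The connected component of G containing u (as a vertex set {x | u ~> x})
-- is stepwise irregular: it has at least one edge (a graph with no edges,
-- in particular K1, is regular and hence not irregular), and every edge xy
-- of it satisfies |d(x) - d(y)| = 1.  Degrees in a component coincide with
-- degrees in G, so d_G is used.
ComponentSI : ∀ {n} → Graph n → Fin n → Set
ComponentSI {n} G u =
  (∃[ x ] ∃[ y ] (Reachable G u x × Reachable G u y × Adj G x y))
  × (∀ (x y : Fin n) → Reachable G u x → Reachable G u y → Adj G x y →
       ∣ degree G x - degree G y ∣ ≡ 1)

StepwiseIrregular : ∀ {n} → Graph n → Set
StepwiseIrregular {n} G = ∀ (u : Fin n) → ComponentSI G u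

module Submission where

-- Along an edge of a stepwise irregular (SI) graph the degrees differ
-- by exactly one, so they have opposite parities.  Hence (i) no three
-- vertices of an SI graph are pairwise adjacent, and (ii) no vertex can be
-- joined by SI edges to a vertex of degree d and to one of degree d + 1.
-- Now let G and G - v both be SI.  Since every vertex of an SI graph lies
-- on an edge, v has a neighbour u, and u has a neighbour w in G - v.  If w
-- is adjacent to v, then v, u, w form a triangle, contradicting (i).
-- Otherwise deleting v lowers the degree of u by one and leaves the degree
-- of w unchanged, so the edge uw is SI both for degrees d_G and d_{G-v},
-- contradicting (ii).

open import Defs
open import Data.Nat.Base using (ℕ; zero; suc; _+_; ∣_-_∣; parity)
open import Data.Nat.Properties using (+-0-commutativeMonoid)
open import Data.Nat.ListAction using (sum)
open import Data.Parity.Base using (_⁻¹)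
open import Data.Parity.Properties using (suc-homo-⁻¹; ⁻¹-selfInverse; ⁻¹-involutive; p≢p⁻¹)
open import Data.Fin.Base using (Fin; punchIn; punchOut)
open import Data.Fin.Properties using (punchIn-punchOut)
open import Data.Bool.Base using (Bool; true; false; if_then_else_)
open import Data.List.Base using (map; tabulate; allFin)
open import Data.List.Properties using (map-tabulate)
open import Data.Product.Base using (_,_; proj₁; proj₂; ∃-syntax)
open import Data.Empty using (⊥)
open import Function.Base using (id; _∘_)
open import Relation.Nullary using (¬_)
open import Relation.Binary.PropositionalEquality
  using (_≡_; _≢_; refl; trans; cong; subst₂; module ≡-Reasoning)
  renaming (sym to ≡-sym)
open import Algebra.Properties.CommutativeMonoid.Sum +-0-commutativeMonoid
  using (sum-remove)
  renaming (sum to ∑)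

parity-suc : ∀ n → parity (suc n) ≡ parity n ⁻¹
parity-suc n = ≡-sym (⁻¹-selfInverse (suc-homo-⁻¹ n))

unit-gap⇒opposite-parity : ∀ a b → ∣ a - b ∣ ≡ 1 → parity a ≡ parity b ⁻¹
unit-gap⇒opposite-parity zero          (suc zero)    _   = refl
unit-gap⇒opposite-parity (suc zero)    zero          _   = refl
unit-gap⇒opposite-parity (suc a)       (suc b)       gap = begin
  parity (suc a)       ≡⟨ parity-suc a ⟩
  parity a ⁻¹          ≡⟨ cong _⁻¹ (unit-gap⇒opposite-parity a b gap) ⟩
  parity b ⁻¹ ⁻¹       ≡⟨ cong _⁻¹ (≡-sym (parity-suc b)) ⟩
  parity (suc b) ⁻¹    ∎
  where open ≡-Reasoning
unit-gap⇒opposite-parity zero          zero          ()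
unit-gap⇒opposite-parity zero          (suc (suc _)) ()
unit-gap⇒opposite-parity (suc (suc _)) zero          ()

-- Three naturals cannot be pairwise at distance one (an odd cycle cannot
-- alternate parity).
no-unit-gap-triangle : ∀ a b c → ∣ a - b ∣ ≡ 1 → ∣ b - c ∣ ≡ 1 → ∣ c - a ∣ ≡ 1 → ⊥
no-unit-gap-triangle a b c ab bc ca = p≢p⁻¹ (parity a) (begin
  parity a             ≡⟨ unit-gap⇒opposite-parity a b ab ⟩
  parity b ⁻¹          ≡⟨ cong _⁻¹ (unit-gap⇒opposite-parity b c bc) ⟩
  parity c ⁻¹ ⁻¹       ≡⟨ ⁻¹-involutive (parity c) ⟩
  parity c             ≡⟨ unit-gap⇒opposite-parity c a ca ⟩
  parity a ⁻¹          ∎)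
  where open ≡-Reasoning

no-unit-gap-to-consecutive : ∀ d b → ∣ suc d - b ∣ ≡ 1 → ∣ d - b ∣ ≡ 1 → ⊥
no-unit-gap-to-consecutive d b sd-b d-b = p≢p⁻¹ (parity d) (begin
  parity d             ≡⟨ unit-gap⇒opposite-parity d b d-b ⟩
  parity b ⁻¹          ≡⟨ ≡-sym (unit-gap⇒opposite-parity (suc d) b sd-b) ⟩
  parity (suc d)       ≡⟨ parity-suc d ⟩
  parity d ⁻¹          ∎)
  where open ≡-Reasoning

indicator : Bool → ℕ
indicator b = if b then 1 else 0

sum-tabulate : ∀ n (f : Fin n → ℕ) → sum (tabulate f) ≡ ∑ f
sum-tabulate zero    f = refl
sum-tabulate (suc n) f = cong (f Fin.zero +_) (sum-tabulate n (f ∘ Fin.suc))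

degree≡∑ : ∀ {n} (G : Graph n) x → degree G x ≡ ∑ (λ j → indicator (adj G x j))
degree≡∑ {n} G x = begin
  sum (map f (allFin n))   ≡⟨ cong sum (map-tabulate id f) ⟩
  sum (tabulate f)         ≡⟨ sum-tabulate n f ⟩
  ∑ f                      ∎
  where
  open ≡-Reasoning
  f : Fin n → ℕ
  f j = indicator (adj G x j)

degree-deleteVertex : ∀ {n} (G : Graph (suc n)) v x →
  degree G (punchIn v x) ≡ indicator (adj G (punchIn v x) v) + degree (deleteVertex G v) x
degree-deleteVertex {n} G v x = begin
  degree G (punchIn v x)                       ≡⟨ degree≡∑ G (punchIn v x) ⟩
  ∑ f                                          ≡⟨ sum-remove {i = v} f ⟩
  f v + ∑ (f ∘ punchIn v)                      ≡⟨ cong (f v +_) (≡-sym (degree≡∑ (deleteVertex G v) x)) ⟩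
  f v + degree (deleteVertex G v) x            ∎
  where
  open ≡-Reasoning
  f : Fin (suc n) → ℕ
  f j = indicator (adj G (punchIn v x) j)

si-edge : ∀ {n} {G : Graph n} → StepwiseIrregular G →
  ∀ {x y} → Adj G x y → ∣ degree G x - degree G y ∣ ≡ 1
si-edge si {x} {y} xy = proj₂ (si x) x y here (step xy here) xy

reaches-edge⇒neighbour : ∀ {n} {G : Graph n} {u x y} →
  Reachable G u x → Adj G x y → ∃[ w ] Adj G u w
reaches-edge⇒neighbour {y = y} here                xy = y , xy
reaches-edge⇒neighbour         (step {w = w} uw _) _  = w , uw

si-neighbour : ∀ {n} {G : Graph n} → StepwiseIrregular G → ∀ u → ∃[ w ] Adj G u w
si-neighbour si u =
  let _ , _ , u⇝x , _ , xy = proj₁ (si u)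
  in  reaches-edge⇒neighbour u⇝x xy

neighbour-survives : ∀ {n} (G : Graph (suc n)) {v u} → Adj G v u →
  ∃[ u′ ] Adj G v (punchIn v u′)
neighbour-survives G {v} {u} vu = punchOut v≢u , subst₂ (Adj G) refl (≡-sym (punchIn-punchOut v≢u)) vu
  where
  v≢u : v ≢ u
  v≢u refl with trans (≡-sym vu) (irrefl G v)
  ... | ()

-- If G and G - v are both SI, no neighbour u of v can have a neighbour w
-- in G - v: either v, u, w is a triangle, or deleting v shifts d(u) alone.
no-edge-at-deleted-neighbour : ∀ {n} (G : Graph (suc n)) v {u w} →
  StepwiseIrregular G → StepwiseIrregular (deleteVertex G v) →
  Adj G v (punchIn v u) → Adj (deleteVertex G v) u w → ⊥
no-edge-at-deleted-neighbour {n} G v {u} {w} si si′ vu uw with adj G (punchIn v w) v in wv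
... | true  = no-unit-gap-triangle (degree G v) (degree G (punchIn v u)) (degree G (punchIn v w))
                (si-edge si vu) (si-edge si uw) (si-edge si wv)
... | false = no-unit-gap-to-consecutive (degree G′ u) (degree G′ w) shifted (si-edge si′ uw)
  where
  G′ : Graph n
  G′ = deleteVertex G v
  U W : Fin (suc n)
  U = punchIn v u
  W = punchIn v w
  degU : degree G U ≡ suc (degree G′ u)
  degU = trans (degree-deleteVertex G v u)
               (cong (λ b → indicator b + degree G′ u) (trans (sym G U v) vu))
  degW : degree G W ≡ degree G′ w
  degW = trans (degree-deleteVertex G v w) (cong (λ b → indicator b + degree G′ w) wv)
  shifted : ∣ suc (degree G′ u) - degree G′ w ∣ ≡ 1
  shifted = subst₂ (λ a b → ∣ a - b ∣ ≡ 1) degU degW (si-edge si uw)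

mainTheorem13 : (n : ℕ) (G : Graph (suc n)) → Connected G → StepwiseIrregular G →
    (v : Fin (suc n)) → ¬ StepwiseIrregular (deleteVertex G v)
mainTheorem13 n G _ si v si′ =
  let _ , vu  = si-neighbour si v
      u , vu′ = neighbour-survives G vu
      _ , uw  = si-neighbour si′ u
  in  no-edge-at-deleted-neighbour G v si si′ vu′ uw
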